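{- Let $G\in\mathrm{Mat}_{k\times n}(\mathbb{Z})$ have no zero column, let $J\subseteq J'\subseteq E$ and let $q\in\mathbb{Z}_{>0}$. Then $$\frac{\prod_{\ell=1}^{r(J)}\gcd(q,e_{\ell,J})}{\prod_{\ell=1}^{r(J)}\gcd(q,e_{\ell,J'})}\in\mathbb{Z}_{>0}.$$
   Context: $E=\{1,\dots,n\}$. For nonempty $J\subseteq E$, $r(J)$ is the rank of the submatrix $G_J$ of $G$ consisting of the columns indexed by $J$ and $e_{1,J}\mid\cdots\mid e_{r(J),J}$ are its elementary divisors (the positive diagonal entries of its Smith normal form); $r(\emptyset)=0$; empty products equal $1$. (Note $r(J)\le r(J')$.) -}

module Defs where

open import Data.Nat as ℕ using (ℕ; zero; suc; _<_)
open import Data.Nat.Divisibility using (_∣_)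
open import Data.Integer as ℤ using (ℤ; +_; 0ℤ; 1ℤ)
open import Data.Fin using (Fin; zero; suc; toℕ)
open import Data.Fin.Subset using (Subset; inside; outside)
open import Data.Vec using ([]; _∷_)
open import Data.List using (List; []; _∷_; length; lookup; map)
open import Data.List.Relation.Unary.All using (All)
open import Data.Product using (Σ; _×_)
open import Relation.Binary.PropositionalEquality using (_≡_)
open import Relation.Nullary.Decidable using (⌊_⌋)
open import Relation.Nullary using (¬_)
open import Data.Bool using (if_then_else_)

Mat : ℕ → ℕ → Set
Mat m n = Fin m → Fin n → ℤ

∑ : ∀ {n} → (Fin n → ℤ) → ℤ
∑ {zero}  f = 0ℤ
∑ {suc n} f = f zero ℤ.+ ∑ (λ i → f (suc i))

_⊗_ : ∀ {m n p} → Mat m n → Mat n p → Mat m p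
(A ⊗ B) i j = ∑ (λ l → A i l ℤ.* B l j)

idMat : ∀ {n} → Mat n n
idMat i j = if ⌊ toℕ i ℕ.≟ toℕ j ⌋ then 1ℤ else 0ℤ

Unimodular : ∀ {n} → Mat n n → Set
Unimodular {n} U = Σ (Mat n n) λ W →
  (∀ i j → (U ⊗ W) i j ≡ idMat i j) × (∀ i j → (W ⊗ U) i j ≡ idMat i j)

members : ∀ {n} → Subset n → List (Fin n)
members {zero}  []            = []
members {suc n} (inside ∷ p)  = zero ∷ map suc (members p)
members {suc n} (outside ∷ p) = map suc (members p)

cols : ∀ {k n} → Mat k n → (J : Subset n) → Mat k (length (members J))
cols G J i j = G i (lookup (members J) j)

-- ℓ-th entry of a list (0-based), 0 if out of range
nth : List ℕ → ℕ → ℕ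
nth []       _       = 0
nth (x ∷ xs) zero    = x
nth (x ∷ xs) (suc l) = nth xs l

diagMat : ∀ {k m} → List ℕ → Mat k m
diagMat e i j = if ⌊ toℕ i ℕ.≟ toℕ j ⌋ then + nth e (toℕ i) else 0ℤ

data Chain : List ℕ → Set where
  []  : Chain []
  [_] : ∀ x → Chain (x ∷ [])
  _∷_ : ∀ {x y ys} → x ∣ y → Chain (y ∷ ys) → Chain (x ∷ y ∷ ys)

-- e = (e₁,…,e_r) is the list of elementary divisors of A, i.e. the positive
-- diagonal entries of a Smith normal form U A V = diag(e₁,…,e_r,0,…,0)
-- (r = length e is then the rank of A)
IsElemDivs : ∀ {k m} → Mat k m → List ℕ → Set
IsElemDivs {k} {m} A e =
  (length e ℕ.≤ k) × (length e ℕ.≤ m) × All (0 <_) e × Chain e ×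
  Σ (Mat k k) λ U → Σ (Mat m m) λ V → Unimodular U × Unimodular V ×
    (∀ i j → ((U ⊗ A) ⊗ V) i j ≡ diagMat e i j)

NoZeroColumn : ∀ {k n} → Mat k n → Set
NoZeroColumn {k} {n} G = ∀ (j : Fin n) → Σ (Fin k) λ i → ¬ (G i j ≡ 0ℤ)

{-# OPTIONS --safe #-}
-- Let U A V = diag(e) and U′ A′ V′ = diag(e′) be Smith forms of A = G_J and A′ = G_J′. The rows of
-- U′ A′ = diag(e′) V′⁻¹ are divisible by e′, and every column of A is a column of A′, so the
-- invertible matrix M = U′ U⁻¹ satisfies e′_a ∣ M_ab e_b, because M diag(e) = U′ A V. With the
-- divisor chains this gives e′_ℓ ∣ M_ab e_ℓ whenever b ≤ ℓ ≤ a, so g = e′_ℓ / gcd(e′_ℓ, e_ℓ)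
-- divides the whole lower-left block of M made of rows ℓ, …, k − 1 and columns 0, …, ℓ. For an
-- invertible M this forces g = 1: otherwise v ↦ (first ℓ entries of M v) mod g would inject
-- (ℤ/g)^(ℓ+1) into (ℤ/g)^ℓ. Hence e′_ℓ ∣ e_ℓ for all ℓ < r(J), and since gcd(q, -) preserves
-- divisibility the denominator divides the numerator; the quotient is positive as q > 0.
module Submission where

open import Defs

module Matrices where
  open import Data.Nat as ℕ using (ℕ; suc; _<_)
  open import Data.Nat.Properties using (<-≤-trans)
  open import Data.Integer using (ℤ; +_; 0ℤ; 1ℤ; _+_; _*_; _-_)
  open import Data.Integer.Properties
    using (+-identityˡ; +-identityʳ; *-zeroˡ; *-zeroʳ; *-identityˡ; *-identityʳ; *-assoc; +-*-semiring)
  open import Data.Integer.Divisibility.Signed using (_∣_; divides; ∣-refl; ∣m∣n⇒∣m+n; ∣m⇒∣m*n)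
  open import Data.Integer.Tactic.RingSolver using (solve-∀)
  open import Algebra.Properties.Semiring.Sum +-*-semiring
    using (sum; sum-cong-≗; sum-replicate-zero; ∑-comm; *-distribˡ-sum; *-distribʳ-sum)
  open import Data.Fin using (Fin; zero; suc; toℕ; fromℕ<)
  open import Data.Fin.Properties using (toℕ-injective; suc-injective; toℕ-fromℕ<)
  open import Data.List using (List; length)
  open import Data.Vec.Functional.Relation.Binary.Pointwise.Properties as Pointwise using ()
  open import Data.Product using (Σ; _×_; _,_; proj₁; proj₂)
  open import Function using (_∘_)
  open import Relation.Binary.Bundles using (Setoid)
  open import Relation.Binary.PropositionalEquality as ≡
    using (_≡_; _≢_; refl; sym; trans; cong; cong₂; subst; module ≡-Reasoning)
  open import Relation.Nullary using (yes; no; contradiction)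

  ∑≡sum : ∀ {n} (f : Fin n → ℤ) → ∑ f ≡ sum f
  ∑≡sum {ℕ.zero} f = refl
  ∑≡sum {suc n}  f = cong (_+_ (f zero)) (∑≡sum (f ∘ suc))

  ⊗-sum : ∀ {m n p} (A : Mat m n) (B : Mat n p) i j → (A ⊗ B) i j ≡ sum (λ l → A i l * B l j)
  ⊗-sum A B i j = ∑≡sum (λ l → A i l * B l j)

  sum-δ : ∀ {n} (f : Fin n → ℤ) b → (∀ l → l ≢ b → f l ≡ 0ℤ) → sum f ≡ f b
  sum-δ {suc n} f zero f≡0 = begin
    f zero + sum (f ∘ suc)             ≡⟨ cong (_+_ (f zero)) (sum-cong-≗ (λ l → f≡0 (suc l) λ ())) ⟩
    f zero + sum (λ (_ : Fin n) → 0ℤ)  ≡⟨ cong (_+_ (f zero)) (sum-replicate-zero n) ⟩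
    f zero + 0ℤ                        ≡⟨ +-identityʳ (f zero) ⟩
    f zero                             ∎
    where open ≡-Reasoning
  sum-δ {suc n} f (suc b) f≡0 = begin
    f zero + sum (f ∘ suc)  ≡⟨ cong₂ _+_ (f≡0 zero λ ()) (sum-δ (f ∘ suc) b f∘suc≡0) ⟩
    0ℤ + f (suc b)          ≡⟨ +-identityˡ (f (suc b)) ⟩
    f (suc b)               ∎
    where
    open ≡-Reasoning
    f∘suc≡0 : ∀ l → l ≢ b → f (suc l) ≡ 0ℤ
    f∘suc≡0 l l≢b = f≡0 (suc l) (l≢b ∘ suc-injective)

  sum-distrib-- : ∀ {n} (f g : Fin n → ℤ) → sum (λ i → f i - g i) ≡ sum f - sum g
  sum-distrib-- {ℕ.zero} f g = refl
  sum-distrib-- {suc n}  f g =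
    trans (cong (_+_ (f zero - g zero)) (sum-distrib-- (f ∘ suc) (g ∘ suc)))
          (regroup (f zero) (g zero) (sum (f ∘ suc)) (sum (g ∘ suc)))
    where
    regroup : ∀ a b c d → (a - b) + (c - d) ≡ (a + c) - (b + d)
    regroup = solve-∀

  ∣-sum : ∀ {n} {d} {f : Fin n → ℤ} → (∀ i → d ∣ f i) → d ∣ sum f
  ∣-sum {ℕ.zero} _   = divides 0ℤ refl
  ∣-sum {suc n}  d∣f = ∣m∣n⇒∣m+n (d∣f zero) (∣-sum (d∣f ∘ suc))

  idMat-diag : ∀ {n} (i : Fin n) → idMat i i ≡ 1ℤ
  idMat-diag i with toℕ i ℕ.≟ toℕ i
  ... | yes _  = refl
  ... | no i≢i = contradiction refl i≢i

  idMat-off : ∀ {n} {i j : Fin n} → i ≢ j → idMat i j ≡ 0ℤ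
  idMat-off {i = i} {j} i≢j with toℕ i ℕ.≟ toℕ j
  ... | yes i≡j = contradiction (toℕ-injective i≡j) i≢j
  ... | no _    = refl

  Mat-setoid : ℕ → ℕ → Setoid _ _
  Mat-setoid m n = Pointwise.setoid (Pointwise.setoid (≡.setoid ℤ) n) m

  infix 4 _≐_
  _≐_ : ∀ {m n} → Mat m n → Mat m n → Set
  _≐_ {m} {n} = Setoid._≈_ (Mat-setoid m n)

  ⊗-cong : ∀ {m n p} {A A′ : Mat m n} {B B′ : Mat n p} → A ≐ A′ → B ≐ B′ → A ⊗ B ≐ A′ ⊗ B′
  ⊗-cong {A = A} {A′} {B} {B′} A≐A′ B≐B′ i j = begin
    (A ⊗ B) i j                  ≡⟨ ⊗-sum A B i j ⟩
    sum (λ l → A i l * B l j)    ≡⟨ sum-cong-≗ (λ l → cong₂ _*_ (A≐A′ i l) (B≐B′ l j)) ⟩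
    sum (λ l → A′ i l * B′ l j)  ≡⟨ ⊗-sum A′ B′ i j ⟨
    (A′ ⊗ B′) i j                ∎
    where open ≡-Reasoning

  ⊗-congˡ : ∀ {m n p} (A : Mat m n) {B B′ : Mat n p} → B ≐ B′ → A ⊗ B ≐ A ⊗ B′
  ⊗-congˡ A = ⊗-cong {A = A} (λ _ _ → refl)

  ⊗-congʳ : ∀ {m n p} {A A′ : Mat m n} (B : Mat n p) → A ≐ A′ → A ⊗ B ≐ A′ ⊗ B
  ⊗-congʳ B A≐A′ = ⊗-cong {B = B} A≐A′ (λ _ _ → refl)

  ⊗-assoc : ∀ {m n p r} (A : Mat m n) (B : Mat n p) (C : Mat p r) → (A ⊗ B) ⊗ C ≐ A ⊗ (B ⊗ C)
  ⊗-assoc A B C i j = begin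
    ((A ⊗ B) ⊗ C) i j
      ≡⟨ ⊗-sum (A ⊗ B) C i j ⟩
    sum (λ p → (A ⊗ B) i p * C p j)
      ≡⟨ sum-cong-≗ (λ p → cong (_* C p j) (⊗-sum A B i p)) ⟩
    sum (λ p → sum (λ l → A i l * B l p) * C p j)
      ≡⟨ sum-cong-≗ (λ p → *-distribʳ-sum (C p j) (λ l → A i l * B l p)) ⟩
    sum (λ p → sum (λ l → A i l * B l p * C p j))
      ≡⟨ ∑-comm (λ p l → A i l * B l p * C p j) ⟩
    sum (λ l → sum (λ p → A i l * B l p * C p j))
      ≡⟨ sum-cong-≗ (λ l → sum-cong-≗ (λ p → *-assoc (A i l) (B l p) (C p j))) ⟩
    sum (λ l → sum (λ p → A i l * (B l p * C p j)))
      ≡⟨ sum-cong-≗ (λ l → *-distribˡ-sum (A i l) (λ p → B l p * C p j)) ⟨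
    sum (λ l → A i l * sum (λ p → B l p * C p j))
      ≡⟨ sum-cong-≗ (λ l → cong (A i l *_) (⊗-sum B C l j)) ⟨
    sum (λ l → A i l * (B ⊗ C) l j)
      ≡⟨ ⊗-sum A (B ⊗ C) i j ⟨
    (A ⊗ (B ⊗ C)) i j
      ∎
    where open ≡-Reasoning

  ⊗-identityˡ : ∀ {m n} (A : Mat m n) → idMat ⊗ A ≐ A
  ⊗-identityˡ A i j = begin
    (idMat ⊗ A) i j                ≡⟨ ⊗-sum idMat A i j ⟩
    sum (λ l → idMat i l * A l j)  ≡⟨ sum-δ _ i off ⟩
    idMat i i * A i j              ≡⟨ cong (_* A i j) (idMat-diag i) ⟩
    1ℤ * A i j                     ≡⟨ *-identityˡ (A i j) ⟩
    A i j                          ∎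
    where
    open ≡-Reasoning
    off : ∀ l → l ≢ i → idMat i l * A l j ≡ 0ℤ
    off l l≢i = trans (cong (_* A l j) (idMat-off (l≢i ∘ sym))) (*-zeroˡ (A l j))

  ⊗-identityʳ : ∀ {m n} (A : Mat m n) → A ⊗ idMat ≐ A
  ⊗-identityʳ A i j = begin
    (A ⊗ idMat) i j                ≡⟨ ⊗-sum A idMat i j ⟩
    sum (λ l → A i l * idMat l j)  ≡⟨ sum-δ _ j off ⟩
    A i j * idMat j j              ≡⟨ cong (A i j *_) (idMat-diag j) ⟩
    A i j * 1ℤ                     ≡⟨ *-identityʳ (A i j) ⟩
    A i j                          ∎
    where
    open ≡-Reasoning
    off : ∀ l → l ≢ j → A i l * idMat l j ≡ 0ℤ
    off l l≢j = trans (cong (A i l *_) (idMat-off l≢j)) (*-zeroʳ (A i l))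

  module _ {m n p : ℕ} where
    open import Relation.Binary.Reasoning.Setoid (Mat-setoid m p)

    ⊗-cancelˡ : ∀ {W : Mat m n} {U : Mat n m} (X : Mat m p) → W ⊗ U ≐ idMat → W ⊗ (U ⊗ X) ≐ X
    ⊗-cancelˡ {W} {U} X W⊗U≐I = begin
      W ⊗ (U ⊗ X)  ≈⟨ ⊗-assoc W U X ⟨
      (W ⊗ U) ⊗ X  ≈⟨ ⊗-congʳ X W⊗U≐I ⟩
      idMat ⊗ X    ≈⟨ ⊗-identityˡ X ⟩
      X            ∎

    ⊗-cancelʳ : ∀ {V : Mat p n} {W : Mat n p} (X : Mat m p) → V ⊗ W ≐ idMat → (X ⊗ V) ⊗ W ≐ X
    ⊗-cancelʳ {V} {W} X V⊗W≐I = begin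
      (X ⊗ V) ⊗ W  ≈⟨ ⊗-assoc X V W ⟩
      X ⊗ (V ⊗ W)  ≈⟨ ⊗-congˡ X V⊗W≐I ⟩
      X ⊗ idMat    ≈⟨ ⊗-identityʳ X ⟩
      X            ∎

  LeftInvertible : ∀ {k} → Mat k k → Set
  LeftInvertible {k} M = Σ (Mat k k) λ N → N ⊗ M ≐ idMat

  ⊗-leftInvertible : ∀ {k} (A B : Mat k k) → LeftInvertible A → LeftInvertible B → LeftInvertible (A ⊗ B)
  ⊗-leftInvertible A B (A⁻¹ , A⁻¹⊗A≐I) (B⁻¹ , B⁻¹⊗B≐I) = B⁻¹ ⊗ A⁻¹ , λ i j → begin
    ((B⁻¹ ⊗ A⁻¹) ⊗ (A ⊗ B)) i j  ≡⟨ ⊗-assoc B⁻¹ A⁻¹ (A ⊗ B) i j ⟩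
    (B⁻¹ ⊗ (A⁻¹ ⊗ (A ⊗ B))) i j  ≡⟨ ⊗-congˡ B⁻¹ (⊗-cancelˡ {W = A⁻¹} {A} B A⁻¹⊗A≐I) i j ⟩
    (B⁻¹ ⊗ B) i j                 ≡⟨ B⁻¹⊗B≐I i j ⟩
    idMat i j                     ∎
    where open ≡-Reasoning

  ⊗-distribˡ-- : ∀ {m n p} (A : Mat m n) (B C : Mat n p) →
    A ⊗ (λ i j → B i j - C i j) ≐ λ i j → (A ⊗ B) i j - (A ⊗ C) i j
  ⊗-distribˡ-- A B C i j = begin
    (A ⊗ (λ i j → B i j - C i j)) i j
      ≡⟨ ⊗-sum A (λ i j → B i j - C i j) i j ⟩
    sum (λ l → A i l * (B l j - C l j))
      ≡⟨ sum-cong-≗ (λ l → distrib (A i l) (B l j) (C l j)) ⟩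
    sum (λ l → A i l * B l j - A i l * C l j)
      ≡⟨ sum-distrib-- (λ l → A i l * B l j) (λ l → A i l * C l j) ⟩
    sum (λ l → A i l * B l j) - sum (λ l → A i l * C l j)
      ≡⟨ cong₂ _-_ (⊗-sum A B i j) (⊗-sum A C i j) ⟨
    (A ⊗ B) i j - (A ⊗ C) i j
      ∎
    where
    open ≡-Reasoning
    distrib : ∀ a b c → a * (b - c) ≡ a * b - a * c
    distrib = solve-∀

  ∣-⊗ : ∀ {m n p} {d} (A : Mat m n) (B : Mat n p) i j → (∀ l → d ∣ A i l * B l j) → d ∣ (A ⊗ B) i j
  ∣-⊗ {d = d} A B i j d∣terms = subst (d ∣_) (sym (⊗-sum A B i j)) (∣-sum d∣terms)

  row-∣-⊗ : ∀ {m n p} {d} (A : Mat m n) (B : Mat n p) i → (∀ l → d ∣ A i l) → ∀ j → d ∣ (A ⊗ B) i j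
  row-∣-⊗ A B i d∣row j = ∣-⊗ A B i j (λ l → ∣m⇒∣m*n (B l j) (d∣row l))

  ⊗-column : ∀ {r k m m′} (A : Mat r k) (B : Mat k m) (B′ : Mat k m′) {j j′} →
    (∀ l → B l j ≡ B′ l j′) → ∀ i → (A ⊗ B) i j ≡ (A ⊗ B′) i j′
  ⊗-column A B B′ {j} {j′} B≡B′ i = begin
    (A ⊗ B) i j                  ≡⟨ ⊗-sum A B i j ⟩
    sum (λ l → A i l * B l j)    ≡⟨ sum-cong-≗ (λ l → cong (A i l *_) (B≡B′ l)) ⟩
    sum (λ l → A i l * B′ l j′)  ≡⟨ ⊗-sum A B′ i j′ ⟨
    (A ⊗ B′) i j′                ∎
    where open ≡-Reasoning

  infix 4 _⊆ᶜ_
  _⊆ᶜ_ : ∀ {k m m′} → Mat k m → Mat k m′ → Set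
  _⊆ᶜ_ {m′ = m′} A A′ = ∀ j → Σ (Fin m′) λ j′ → ∀ i → A i j ≡ A′ i j′

  diagMat-∣ : ∀ {k m} (e : List ℕ) (i : Fin k) (j : Fin m) → + nth e (toℕ i) ∣ diagMat e i j
  diagMat-∣ e i j with toℕ i ℕ.≟ toℕ j
  ... | yes _ = ∣-refl
  ... | no _  = divides 0ℤ refl

  ⊗-diagMat : ∀ {r k m} (A : Mat r k) (e : List ℕ) {b : Fin k} {j : Fin m} → toℕ b ≡ toℕ j →
    ∀ i → (A ⊗ diagMat e) i j ≡ A i b * + nth e (toℕ b)
  ⊗-diagMat A e {b} {j} b≡j i = begin
    (A ⊗ diagMat e) i j                ≡⟨ ⊗-sum A (diagMat e) i j ⟩
    sum (λ l → A i l * diagMat e l j)  ≡⟨ sum-δ _ b off ⟩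
    A i b * diagMat e b j              ≡⟨ cong (A i b *_) diagMat-diag ⟩
    A i b * + nth e (toℕ b)            ∎
    where
    open ≡-Reasoning
    diagMat-off : ∀ l → l ≢ b → diagMat e l j ≡ 0ℤ
    diagMat-off l l≢b with toℕ l ℕ.≟ toℕ j
    ... | yes l≡j = contradiction (toℕ-injective (trans l≡j (sym b≡j))) l≢b
    ... | no _    = refl
    diagMat-diag : diagMat e b j ≡ + nth e (toℕ b)
    diagMat-diag with toℕ b ℕ.≟ toℕ j
    ... | yes _   = refl
    ... | no b≢j  = contradiction b≡j b≢j
    off : ∀ l → l ≢ b → A i l * diagMat e l j ≡ 0ℤ
    off l l≢b = trans (cong (A i l *_) (diagMat-off l l≢b)) (*-zeroʳ (A i l))

  smith-row-∣ : ∀ {k m} (e : List ℕ) (U : Mat k k) (A : Mat k m) (V W : Mat m m) →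
    (U ⊗ A) ⊗ V ≐ diagMat e → V ⊗ W ≐ idMat → ∀ a j → + nth e (toℕ a) ∣ (U ⊗ A) a j
  smith-row-∣ e U A V W UAV≐D V⊗W≐I a j =
    subst (_ ∣_) (⊗-cancelʳ {V = V} (U ⊗ A) V⊗W≐I a j)
      (row-∣-⊗ ((U ⊗ A) ⊗ V) W a (λ l → subst (_ ∣_) (sym (UAV≐D a l)) (diagMat-∣ e a l)) j)

  elemDivs-transition : ∀ {k m m′} {A : Mat k m} {A′ : Mat k m′} {e e′ : List ℕ} →
    IsElemDivs A e → IsElemDivs A′ e′ → A ⊆ᶜ A′ →
    Σ (Mat k k) λ M → LeftInvertible M ×
      ∀ a b → toℕ b < length e → + nth e′ (toℕ a) ∣ M a b * + nth e (toℕ b)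
  elemDivs-transition {A = A} {A′} {e} {e′}
    (_ , e≤m , _ , _ , U , V , (U⁻¹ , U⊗U⁻¹≐I , U⁻¹⊗U≐I) , _ , UAV≐D)
    (_ , _ , _ , _ , U′ , V′ , (U′⁻¹ , _ , U′⁻¹⊗U′≐I) , (V′⁻¹ , V′⊗V′⁻¹≐I , _) , U′A′V′≐D′)
    A⊆A′ = U′ ⊗ U⁻¹ , ⊗-leftInvertible U′ U⁻¹ (U′⁻¹ , U′⁻¹⊗U′≐I) (U , U⊗U⁻¹≐I) , divisible
    where
    row-of-U′A : ∀ a l → + nth e′ (toℕ a) ∣ (U′ ⊗ A) a l
    row-of-U′A a l = subst (_ ∣_) (sym (⊗-column U′ A A′ (proj₂ (A⊆A′ l)) a))
                       (smith-row-∣ e′ U′ A′ V′ V′⁻¹ U′A′V′≐D′ V′⊗V′⁻¹≐I a (proj₁ (A⊆A′ l)))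
    U⊗AV≐D : U ⊗ (A ⊗ V) ≐ diagMat e
    U⊗AV≐D i l = trans (sym (⊗-assoc U A V i l)) (UAV≐D i l)
    entry : ∀ a b (j : Fin _) → toℕ b ≡ toℕ j → ((U′ ⊗ A) ⊗ V) a j ≡ (U′ ⊗ U⁻¹) a b * + nth e (toℕ b)
    entry a b j b≡j = begin
      ((U′ ⊗ A) ⊗ V) a j                 ≡⟨ ⊗-assoc U′ A V a j ⟩
      (U′ ⊗ (A ⊗ V)) a j                 ≡⟨ ⊗-congˡ U′ (⊗-cancelˡ {W = U⁻¹} {U} (A ⊗ V) U⁻¹⊗U≐I) a j ⟨
      (U′ ⊗ (U⁻¹ ⊗ (U ⊗ (A ⊗ V)))) a j  ≡⟨ ⊗-assoc U′ U⁻¹ (U ⊗ (A ⊗ V)) a j ⟨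
      ((U′ ⊗ U⁻¹) ⊗ (U ⊗ (A ⊗ V))) a j  ≡⟨ ⊗-congˡ (U′ ⊗ U⁻¹) U⊗AV≐D a j ⟩
      ((U′ ⊗ U⁻¹) ⊗ diagMat e) a j       ≡⟨ ⊗-diagMat (U′ ⊗ U⁻¹) e b≡j a ⟩
      (U′ ⊗ U⁻¹) a b * + nth e (toℕ b)   ∎
      where open ≡-Reasoning
    divisible : ∀ a b → toℕ b < length e → + nth e′ (toℕ a) ∣ (U′ ⊗ U⁻¹) a b * + nth e (toℕ b)
    divisible a b b<e = subst (_ ∣_) (entry a b j (sym (toℕ-fromℕ< b<m)))
                          (row-∣-⊗ (U′ ⊗ A) V a (row-of-U′A a) j)
      where
      b<m = <-≤-trans b<e e≤m
      j = fromℕ< b<m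

module Counting where
  open Matrices
  open import Data.Nat as ℕ using (ℕ; zero; suc; _<_; _≤_; _^_; s≤s; z≤n; NonZero)
  open import Data.Nat.Properties
    using (<⇒≤; ≤-<-connex; <-≤-connex; ⊔-lub; ≤-trans; ^-monoʳ-<; n<1+n; <⇒≱)
  open import Data.Nat.Divisibility as ℕ using (>⇒∤)
  open import Data.Integer using (ℤ; +_; 0ℤ; _-_; _*_; ∣_∣)
  open import Data.Integer.Properties using (m-n≡m⊖n; ∣m⊝n∣≤m⊔n; ∣i∣≡0⇒i≡0; i-j≡0⇒i≡j; +-injective)
  open import Data.Integer.DivMod using (_%ℕ_; _/ℕ_; n%ℕd<d; a≡a%ℕn+[a/ℕn]*n)
  open import Data.Integer.Divisibility.Signed using (_∣_; divides; ∣⇒∣ᵤ; ∣m⇒∣m*n; ∣n⇒∣m*n)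
  open import Data.Integer.Tactic.RingSolver using (solve-∀)
  open import Data.Fin using (Fin; zero; suc; toℕ; fromℕ<; inject≤; combine; funToFin; finToFun)
  open import Data.Fin.Properties
    using (toℕ-injective; toℕ-fromℕ<; toℕ-inject≤; toℕ<n; injective⇒≤; finToFun-funToFin; funToFin-finToFin)
  open import Data.Product using (proj₁; proj₂)
  open import Data.Sum using (inj₁; inj₂)
  open import Function using (_∘_)
  open import Relation.Binary.PropositionalEquality
    using (_≡_; _≗_; refl; sym; trans; cong; cong₂; subst; subst₂; module ≡-Reasoning)
  open import Relation.Nullary using (yes; no; contradiction)

  funToFin-cong : ∀ {m n} {f h : Fin m → Fin n} → f ≗ h → funToFin f ≡ funToFin h
  funToFin-cong {zero}  _   = refl
  funToFin-cong {suc m} f≗h = cong₂ combine (f≗h zero) (funToFin-cong (f≗h ∘ suc))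

  injective⇒^≤^ : ∀ {m n g} (F : (Fin m → Fin g) → (Fin n → Fin g)) →
    (∀ v w → F v ≗ F w → v ≗ w) → g ^ m ≤ g ^ n
  injective⇒^≤^ {m} {n} {g} F F-injective = injective⇒≤ {f = funToFin ∘ F ∘ finToFun} injective
    where
    injective : ∀ {x y} → funToFin (F (finToFun x)) ≡ funToFin (F (finToFun y)) → x ≡ y
    injective {x} {y} eq = begin
      x                          ≡⟨ funToFin-finToFin {m} {g} x ⟨
      funToFin {m} (finToFun x)  ≡⟨ funToFin-cong (F-injective _ _ F-eq) ⟩
      funToFin {m} (finToFun y)  ≡⟨ funToFin-finToFin {m} {g} y ⟩
      y                          ∎
      where
      open ≡-Reasoning
      F-eq : F (finToFun x) ≗ F (finToFun y)
      F-eq i = trans (sym (finToFun-funToFin (F (finToFun x)) i))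
                 (trans (cong (λ z → finToFun z i) eq) (finToFun-funToFin (F (finToFun y)) i))

  residue : ∀ g .{{_ : NonZero g}} → ℤ → Fin g
  residue g x = fromℕ< (n%ℕd<d x g)

  residue-≡⇒∣ : ∀ {g} .{{_ : NonZero g}} x y → residue g x ≡ residue g y → + g ∣ x - y
  residue-≡⇒∣ {g} x y same = divides (x /ℕ g - y /ℕ g) (begin
    x - y
      ≡⟨ cong₂ _-_ (a≡a%ℕn+[a/ℕn]*n x g) (a≡a%ℕn+[a/ℕn]*n y g) ⟩
    (+ r + x /ℕ g * + g) - (+ s + y /ℕ g * + g)
      ≡⟨ cong (λ t → (+ r + x /ℕ g * + g) - (+ t + y /ℕ g * + g)) r≡s ⟨
    (+ r + x /ℕ g * + g) - (+ r + y /ℕ g * + g)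
      ≡⟨ cancel (+ r) (x /ℕ g) (y /ℕ g) (+ g) ⟩
    (x /ℕ g - y /ℕ g) * + g
      ∎)
    where
    open ≡-Reasoning
    open Data.Integer using (_+_)
    r = x %ℕ g
    s = y %ℕ g
    r≡s : r ≡ s
    r≡s = trans (sym (toℕ-fromℕ< _)) (trans (cong toℕ same) (toℕ-fromℕ< _))
    cancel : ∀ r p q c → (r + p * c) - (r + q * c) ≡ (p - q) * c
    cancel = solve-∀

  m∣n∧n<m⇒n≡0 : ∀ {m n} → m ℕ.∣ n → n < m → n ≡ 0
  m∣n∧n<m⇒n≡0 {n = zero}  _   _   = refl
  m∣n∧n<m⇒n≡0 {n = suc n} m∣n n<m = contradiction m∣n (>⇒∤ n<m)

  toℕ-∣-injective : ∀ {g} (u v : Fin g) → + g ∣ + toℕ u - + toℕ v → u ≡ v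
  toℕ-∣-injective {g} u v g∣u-v = toℕ-injective (+-injective (i-j≡0⇒i≡j _ _ (∣i∣≡0⇒i≡0 ∣u-v∣≡0)))
    where
    ∣u-v∣<g : ∣ + toℕ u - + toℕ v ∣ < g
    ∣u-v∣<g = subst (_< g) (cong ∣_∣ (sym (m-n≡m⊖n (toℕ u) (toℕ v))))
                (≤-trans (s≤s (∣m⊝n∣≤m⊔n (toℕ u) (toℕ v))) (⊔-lub (toℕ<n u) (toℕ<n v)))
    ∣u-v∣≡0 : ∣ + toℕ u - + toℕ v ∣ ≡ 0
    ∣u-v∣≡0 = m∣n∧n<m⇒n≡0 (∣⇒∣ᵤ g∣u-v) ∣u-v∣<g

  ^-suc≤⇒≡1 : ∀ g l .{{_ : NonZero g}} → g ^ suc l ≤ g ^ l → g ≡ 1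
  ^-suc≤⇒≡1 (suc zero)       l _ = refl
  ^-suc≤⇒≡1 g@(suc (suc _)) l g^[1+l]≤g^l =
    contradiction g^[1+l]≤g^l (<⇒≱ (^-monoʳ-< g (s≤s (s≤s z≤n)) (n<1+n l)))

  pad : ∀ {k l g} → (Fin (suc l) → Fin g) → Mat k 1
  pad {l = l} v b _ with toℕ b ℕ.≤? l
  ... | yes b≤l = + toℕ (v (fromℕ< (s≤s b≤l)))
  ... | no _    = 0ℤ

  pad-outside : ∀ {k l g} (v : Fin (suc l) → Fin g) {b : Fin k} → l < toℕ b → ∀ z → pad v b z ≡ 0ℤ
  pad-outside {l = l} v {b} l<b z with toℕ b ℕ.≤? l
  ... | yes b≤l = contradiction b≤l (<⇒≱ l<b)
  ... | no _    = refl

  pad-inject≤ : ∀ {k l g} (v : Fin (suc l) → Fin g) (i : Fin (suc l)) (l<k : l < k) →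
    ∀ z → pad v (inject≤ i l<k) z ≡ + toℕ (v i)
  pad-inject≤ {l = l} v i l<k z with toℕ (inject≤ i l<k) ℕ.≤? l
  ... | yes i≤l = cong (+_ ∘ toℕ ∘ v) (toℕ-injective (trans (toℕ-fromℕ< (s≤s i≤l)) (toℕ-inject≤ i l<k)))
  ... | no i≰l  = contradiction (subst (_≤ l) (sym (toℕ-inject≤ i l<k)) (ℕ.s≤s⁻¹ (toℕ<n i))) i≰l

  module _ {k l g} .{{_ : NonZero g}} (M : Mat k k) (invertible : LeftInvertible M) (l<k : l < k)
           (g∣block : ∀ a b → toℕ b ≤ l → l ≤ toℕ a → + g ∣ M a b) where

    residues : (Fin (suc l) → Fin g) → Fin l → Fin g
    residues v a = residue g ((M ⊗ pad v) (inject≤ a (<⇒≤ l<k)) zero)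

    module _ (v w : Fin (suc l) → Fin g) where

      pad-difference : Mat k 1
      pad-difference b z = pad v b z - pad w b z

      ∣-⊗-pad-difference : residues v ≗ residues w → ∀ a → + g ∣ (M ⊗ pad-difference) a zero
      ∣-⊗-pad-difference same a with <-≤-connex (toℕ a) l
      ... | inj₁ a<l = subst (+ g ∣_) (sym (⊗-distribˡ-- M (pad v) (pad w) a zero))
                         (residue-≡⇒∣ ((M ⊗ pad v) a zero) ((M ⊗ pad w) a zero)
                           (subst (λ c → residue g ((M ⊗ pad v) c zero) ≡ residue g ((M ⊗ pad w) c zero))
                                  a′≡a (same (fromℕ< a<l))))
        where
        a′≡a : inject≤ (fromℕ< a<l) (<⇒≤ l<k) ≡ a
        a′≡a = toℕ-injective (trans (toℕ-inject≤ (fromℕ< a<l) (<⇒≤ l<k)) (toℕ-fromℕ< a<l))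
      ... | inj₂ l≤a = ∣-⊗ M pad-difference a zero term
        where
        term : ∀ b → + g ∣ M a b * pad-difference b zero
        term b with ≤-<-connex (toℕ b) l
        ... | inj₁ b≤l = ∣m⇒∣m*n (pad-difference b zero) (g∣block a b b≤l l≤a)
        ... | inj₂ l<b = subst (λ x → + g ∣ M a b * x)
                           (sym (cong₂ _-_ (pad-outside v l<b zero) (pad-outside w l<b zero)))
                           (∣n⇒∣m*n (M a b) (divides 0ℤ refl))

    residues-injective : ∀ v w → residues v ≗ residues w → v ≗ w
    residues-injective v w same i = toℕ-∣-injective (v i) (w i)
      (subst₂ (λ x y → + g ∣ x - y) (pad-inject≤ v i l<k zero) (pad-inject≤ w i l<k zero)
              (g∣D (inject≤ i l<k)))
      where
      N = proj₁ invertible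
      g∣D : ∀ b → + g ∣ pad-difference v w b zero
      g∣D b = subst (+ g ∣_) (⊗-cancelˡ {W = N} {M} (pad-difference v w) (proj₂ invertible) b zero)
                (∣-⊗ N (M ⊗ pad-difference v w) b zero
                     (λ a → ∣n⇒∣m*n (N b a) (∣-⊗-pad-difference v w same a)))

    block-divisor≡1 : g ≡ 1
    block-divisor≡1 = ^-suc≤⇒≡1 g l (injective⇒^≤^ residues residues-injective)

open Matrices using (LeftInvertible; _⊆ᶜ_; elemDivs-transition)
open Counting using (block-divisor≡1)
open import Data.Nat
  using (ℕ; zero; suc; _<_; _≤_; _*_; z≤n; s≤s; NonZero; ≢-nonZero; ≢-nonZero⁻¹; >-nonZero; >-nonZero⁻¹)
open import Data.Nat.Properties using (*-comm; *-identityˡ; ≤-<-trans; <-≤-trans)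
open import Data.Nat.Divisibility
  using (_∣_; ∣-refl; ∣-trans; _∣0; 1∣_; *-cancelʳ-∣; *-pres-∣; quotient; quotient≢0; m∣n⇒n≡quotient*m)
open import Data.Nat.DivMod using (_/_; m/n*n≡m)
open import Data.Nat.GCD using (gcd; gcd[m,n]∣m; gcd[m,n]∣n; gcd-greatest; gcd[m,n]≢0; m/gcd[m,n]≢0)
open import Data.Nat.Coprimality using (coprime-/gcd; coprime-divisor)
open import Data.Nat.ListAction using (product)
open import Data.Nat.ListAction.Properties using (product≢0)
open import Data.Nat.Tactic.RingSolver using (solve-∀)
open import Data.Integer as ℤ using (+_)
open import Data.Integer.Properties using (abs-*)
import Data.Integer.Divisibility.Signed as ℤ
open import Data.Fin as Fin using (Fin; toℕ)
open import Data.Fin.Subset using (Subset; _⊆_; _∈_; inside; outside)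
open import Data.Vec using ([]; _∷_; here; there)
open import Data.List using (List; []; _∷_; length; take; map)
open import Data.List.Membership.Propositional using () renaming (_∈_ to _∈ₗ_)
open import Data.List.Membership.Propositional.Properties using (∈-lookup; ∈-map⁺; ∈-map⁻)
open import Data.List.Relation.Unary.Any using (here; there; index)
open import Data.List.Relation.Unary.Any.Properties using (lookup-index)
open import Data.List.Relation.Unary.All using (All; []; _∷_; universal)
open import Data.List.Relation.Unary.All.Properties using (map⁺)
open import Data.Product using (Σ; _×_; _,_)
open import Data.Sum using (inj₁)
open import Relation.Binary.PropositionalEquality
  using (_≡_; refl; sym; trans; cong; subst; subst₂; module ≡-Reasoning)

nth-nonZero : ∀ {e : List ℕ} → All (0 <_) e → ∀ {l} → l < length e → NonZero (nth e l)
nth-nonZero (0<x ∷ _)  {zero}  _         = >-nonZero 0<x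
nth-nonZero (_ ∷ 0<xs) {suc l} (s≤s l<e) = nth-nonZero 0<xs l<e

chain-∣ : ∀ {e} → Chain e → ∀ {i j} → i ≤ j → nth e i ∣ nth e j
chain-∣ []        _                         = ∣-refl
chain-∣ [ x ]     {zero}  {zero}  _         = ∣-refl
chain-∣ [ x ]     {zero}  {suc j} _         = x ∣0
chain-∣ [ x ]     {suc i} {suc j} _         = ∣-refl
chain-∣ (x∣y ∷ c) {zero}  {zero}  _         = ∣-refl
chain-∣ (x∣y ∷ c) {zero}  {suc j} _         = ∣-trans x∣y (chain-∣ c {zero} {j} z≤n)
chain-∣ (x∣y ∷ c) {suc i} {suc j} (s≤s i≤j) = chain-∣ c i≤j

gcd-nonZeroˡ : ∀ x y .{{_ : NonZero x}} → NonZero (gcd x y)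
gcd-nonZeroˡ x y = ≢-nonZero (gcd[m,n]≢0 x y (inj₁ (≢-nonZero⁻¹ x)))

gcd-monoʳ-∣ : ∀ q {x y} → x ∣ y → gcd q x ∣ gcd q y
gcd-monoʳ-∣ q {x} x∣y = gcd-greatest (gcd[m,n]∣m q x) (∣-trans (gcd[m,n]∣n q x) x∣y)

/gcd-∣ : ∀ x y {z} .{{_ : NonZero (gcd x y)}} → x ∣ y * z → x / gcd x y ∣ z
/gcd-∣ x y {z} x∣yz = coprime-divisor (coprime-/gcd x y) (*-cancelʳ-∣ (gcd x y) x/c*c∣y/c*z*c)
  where
  regroup : ∀ a c z → a * c * z ≡ a * z * c
  regroup = solve-∀
  x/c*c∣y/c*z*c : x / gcd x y * gcd x y ∣ y / gcd x y * z * gcd x y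
  x/c*c∣y/c*z*c = subst₂ _∣_ (sym (m/n*n≡m (gcd[m,n]∣m x y)))
    (trans (cong (_* z) (sym (m/n*n≡m (gcd[m,n]∣n x y)))) (regroup (y / gcd x y) (gcd x y) z)) x∣yz

∣-cancel-block : ∀ {k l x y} (M : Mat k k) → LeftInvertible M → l < k → .{{_ : NonZero x}} →
  (∀ a b → toℕ b ≤ l → l ≤ toℕ a → + x ℤ.∣ M a b ℤ.* + y) → x ∣ y
∣-cancel-block {l = l} {x} {y} M invertible l<k x∣My = subst (_∣ y) (sym x≡gcd) (gcd[m,n]∣n x y)
  where
  instance
    gcd≢0 : NonZero (gcd x y)
    gcd≢0 = gcd-nonZeroˡ x y
    x/gcd≢0 : NonZero (x / gcd x y)
    x/gcd≢0 = ≢-nonZero (m/gcd[m,n]≢0 x y)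
  x/gcd∣block : ∀ a b → toℕ b ≤ l → l ≤ toℕ a → + (x / gcd x y) ℤ.∣ M a b
  x/gcd∣block a b b≤l l≤a = ℤ.∣ᵤ⇒∣ (/gcd-∣ x y (subst (x ∣_) (trans (abs-* (M a b) (+ y)) (*-comm _ y))
                                                        (ℤ.∣⇒∣ᵤ (x∣My a b b≤l l≤a))))
  x≡gcd : x ≡ gcd x y
  x≡gcd = begin
    x                      ≡⟨ m/n*n≡m (gcd[m,n]∣m x y) ⟨
    x / gcd x y * gcd x y  ≡⟨ cong (_* gcd x y) (block-divisor≡1 M invertible l<k x/gcd∣block) ⟩
    1 * gcd x y            ≡⟨ *-identityˡ (gcd x y) ⟩
    gcd x y                ∎
    where open ≡-Reasoning

elemDivs-∣ : ∀ {k m m′} {A : Mat k m} {A′ : Mat k m′} {e e′} → IsElemDivs A e → IsElemDivs A′ e′ →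
  A ⊆ᶜ A′ → ∀ l → l < length e → l < length e′ → nth e′ l ∣ nth e l
elemDivs-∣ {e = e} {e′} ed@(e≤k , _ , _ , chain , _) ed′@(_ , _ , 0<e′ , chain′ , _) A⊆A′ l l<e l<e′
  with elemDivs-transition ed ed′ A⊆A′
... | M , invertible , e′∣Me =
  ∣-cancel-block M invertible (<-≤-trans l<e e≤k) {{nth-nonZero 0<e′ l<e′}} block
  where
  block : ∀ a b → toℕ b ≤ l → l ≤ toℕ a → + nth e′ l ℤ.∣ M a b ℤ.* + nth e l
  block a b b≤l l≤a = ℤ.∣-trans (ℤ.∣ᵤ⇒∣ (chain-∣ chain′ l≤a))
    (ℤ.∣-trans (e′∣Me a b (≤-<-trans b≤l l<e)) (ℤ.*-monoʳ-∣ (M a b) (ℤ.∣ᵤ⇒∣ (chain-∣ chain b≤l))))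

product-map-take-∣ : ∀ (f : ℕ → ℕ) → (∀ {x y} → x ∣ y → f x ∣ f y) → ∀ xs ys →
  (∀ l → l < length xs → l < length ys → nth ys l ∣ nth xs l) →
  product (map f (take (length xs) ys)) ∣ product (map f xs)
product-map-take-∣ f f-mono []       ys       _     = ∣-refl
product-map-take-∣ f f-mono (x ∷ xs) []       _     = 1∣ _
product-map-take-∣ f f-mono (x ∷ xs) (y ∷ ys) ys∣xs =
  *-pres-∣ (f-mono (ys∣xs 0 (s≤s z≤n) (s≤s z≤n)))
           (product-map-take-∣ f f-mono xs ys (λ l l<xs l<ys → ys∣xs (suc l) (s≤s l<xs) (s≤s l<ys)))

∈-members⁻ : ∀ {n} (p : Subset n) {x} → x ∈ₗ members p → x ∈ p
∈-members⁻ (inside ∷ p) (here refl) = here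
∈-members⁻ (inside ∷ p) (there x∈p) with ∈-map⁻ Fin.suc x∈p
... | _ , y∈p , refl = there (∈-members⁻ p y∈p)
∈-members⁻ (outside ∷ p) x∈p with ∈-map⁻ Fin.suc x∈p
... | _ , y∈p , refl = there (∈-members⁻ p y∈p)

∈-members⁺ : ∀ {n} (p : Subset n) {x} → x ∈ p → x ∈ₗ members p
∈-members⁺ (inside ∷ p)  here        = here refl
∈-members⁺ (inside ∷ p)  (there x∈p) = there (∈-map⁺ Fin.suc (∈-members⁺ p x∈p))
∈-members⁺ (outside ∷ p) (there x∈p) = ∈-map⁺ Fin.suc (∈-members⁺ p x∈p)

cols-⊆ : ∀ {k n} (G : Mat k n) {J J′ : Subset n} → J ⊆ J′ → cols G J ⊆ᶜ cols G J′
cols-⊆ G {J} {J′} J⊆J′ j = index j∈J′ , λ i → cong (G i) (lookup-index j∈J′)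
  where j∈J′ = ∈-members⁺ J′ (J⊆J′ (∈-members⁻ J (∈-lookup {xs = members J} j)))

-- The divisibility holds for every G: the proof does not use that G has no zero column.
lemma3p13 : (k n : ℕ) (G : Mat k n) → NoZeroColumn G →
    (J J′ : Subset n) → J ⊆ J′ → (q : ℕ) → 0 < q →
    (e e′ : List ℕ) → IsElemDivs (cols G J) e → IsElemDivs (cols G J′) e′ →
    Σ ℕ λ t → 0 < t ×
      (product (map (gcd q) e) ≡ t * product (map (gcd q) (take (length e) e′)))
lemma3p13 k n G _ J J′ J⊆J′ q 0<q e e′ elemDivs elemDivs′ =
  quotient P′∣P , >-nonZero⁻¹ _ {{quotient≢0 P′∣P}} , m∣n⇒n≡quotient*m P′∣P
  where
  instance
    q≢0 : NonZero q
    q≢0 = >-nonZero 0<q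
    P≢0 : NonZero (product (map (gcd q) e))
    P≢0 = product≢0 (map⁺ (universal (λ x → gcd-nonZeroˡ q x) e))
  P′∣P : product (map (gcd q) (take (length e) e′)) ∣ product (map (gcd q) e)
  P′∣P = product-map-take-∣ (gcd q) (gcd-monoʳ-∣ q) e e′
           (elemDivs-∣ elemDivs elemDivs′ (cols-⊆ G J⊆J′))
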